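{- Let $\mathbf{A}$ be an everywhere-nonempty 2-sorted algebra in the signature $\tau$. If $\mathbf{B}\in\mathscr{V}(\mathbf{A})$, then $\mathbf{B}^0\in\mathscr{V}(\mathbf{A}^0)$.
   Context: The signature $\tau$ consists of a single binary operation symbol $s$ of type $1\times 2\to 2$; a 2-sorted algebra in $\tau$ is $(A_1,A_2;s)$ with $s:A_1\times A_2\to A_2$, and it is everywhere nonempty if $A_1,A_2\neq\varnothing$ (only such algebras are considered). Subalgebras, products, homomorphic images are defined sortwise. For an algebra $\mathbf{A}$, $\mathscr{V}(\mathbf{A})$ is the closure of $\{\mathbf{A}\}$ under products, everywhere-nonempty subalgebras and homomorphic images. For $\mathbf{B}=(B_1,B_2;s)$, $\mathbf{B}^0=(B_1^0,B_2^0;s^0)$ where $B_i^0$ is the disjoint union of $B_i$ with a new element $0$, and $s^0(b,b')=s(b,b')$ if $b\in B_1$ and $b'\in B_2$, and $s^0(b,b')=0$ otherwise. -}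

module Defs where

open import Level using (Level; suc)
open import Data.Product using (Σ; _×_; _,_)
open import Data.Maybe using (Maybe; just; nothing)
open import Relation.Binary.PropositionalEquality using (_≡_)
open import Function.Definitions using (Injective; Surjective)

record Alg (ℓ : Level) : Set (suc ℓ) where
  field
    Sort₁ : Set ℓ
    Sort₂ : Set ℓ
    s     : Sort₁ → Sort₂ → Sort₂
open Alg public

EverywhereNonempty : ∀ {ℓ} → Alg ℓ → Set ℓ
EverywhereNonempty A = Sort₁ A × Sort₂ A

record Hom {ℓ} (A B : Alg ℓ) : Set ℓ where
  field
    h₁ : Sort₁ A → Sort₁ B
    h₂ : Sort₂ A → Sort₂ B
    pres : ∀ a x → h₂ (s A a x) ≡ s B (h₁ a) (h₂ x)
open Hom public

IsInjectiveHom : ∀ {ℓ} {A B : Alg ℓ} → Hom A B → Set ℓ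
IsInjectiveHom h = Injective _≡_ _≡_ (h₁ h) × Injective _≡_ _≡_ (h₂ h)

IsSurjectiveHom : ∀ {ℓ} {A B : Alg ℓ} → Hom A B → Set ℓ
IsSurjectiveHom h = Surjective _≡_ _≡_ (h₁ h) × Surjective _≡_ _≡_ (h₂ h)

Π-Alg : ∀ {ℓ} (I : Set ℓ) → (I → Alg ℓ) → Alg ℓ
Π-Alg I C = record
  { Sort₁ = (i : I) → Sort₁ (C i)
  ; Sort₂ = (i : I) → Sort₂ (C i)
  ; s = λ a x i → s (C i) (a i) (x i)
  }

-- 𝒱(A): closure of {A} under products, everywhere-nonempty subalgebras
-- (up to isomorphism: injective homomorphisms) and homomorphic images
-- (surjective homomorphisms).
data 𝒱 {ℓ} (A : Alg ℓ) : Alg ℓ → Set (suc ℓ) where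
  base : 𝒱 A A
  prod : (I : Set ℓ) (C : I → Alg ℓ) → ((i : I) → 𝒱 A (C i)) → 𝒱 A (Π-Alg I C)
  sub  : (B C : Alg ℓ) → 𝒱 A C → EverywhereNonempty B →
         (h : Hom B C) → IsInjectiveHom h → 𝒱 A B
  img  : (B C : Alg ℓ) → 𝒱 A C →
         (h : Hom C B) → IsSurjectiveHom h → 𝒱 A B

-- B⁰ : adjoin a new element 0 (= nothing) to each sort
s⁰ : ∀ {ℓ} (B : Alg ℓ) → Maybe (Sort₁ B) → Maybe (Sort₂ B) → Maybe (Sort₂ B)
s⁰ B (just b) (just b') = just (s B b b')
s⁰ B _        _         = nothing

_⁰ : ∀ {ℓ} → Alg ℓ → Alg ℓ
B ⁰ = record { Sort₁ = Maybe (Sort₁ B) ; Sort₂ = Maybe (Sort₂ B) ; s = s⁰ B }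

-- A embeds into A⁰ via b ↦ b, so B ∈ 𝒱(A) ⊆ 𝒱(A⁰). In B × A⁰ the second
-- coordinate acts as a flag: (b , m) ↦ (0 if m = 0, b otherwise) is a
-- homomorphism B × A⁰ → B⁰, since s⁰ yields 0 exactly when an argument is 0,
-- i.e. exactly when the flag s⁰(m , m') of the result is 0. It is onto because
-- A and B are nonempty, so B⁰ is a homomorphic image of B × A⁰ ∈ 𝒱(A⁰).
module Submission where

open import Level using (Level; Lift; lift)
open import Data.Bool using (Bool; true; false)
open import Data.Maybe using (Maybe; just; nothing)
open import Data.Maybe.Properties using (just-injective)
open import Data.Product using (_,_; proj₁; proj₂)
open import Relation.Binary.PropositionalEquality using (_≡_; refl)
open import Function.Definitions using (Surjective)
open import Defs

private
  variable
    ℓ : Level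

𝒱-trans : {A A′ B : Alg ℓ} → 𝒱 A′ A → 𝒱 A B → 𝒱 A′ B
𝒱-trans A∈ base                = A∈
𝒱-trans A∈ (prod I C C∈)       = prod I C (λ i → 𝒱-trans A∈ (C∈ i))
𝒱-trans A∈ (sub B C C∈ ne h i) = sub B C (𝒱-trans A∈ C∈) ne h i
𝒱-trans A∈ (img B C C∈ h s)    = img B C (𝒱-trans A∈ C∈) h s

𝒱-nonempty : {A B : Alg ℓ} → EverywhereNonempty A → 𝒱 A B → EverywhereNonempty B
𝒱-nonempty ne base                 = ne
𝒱-nonempty ne (prod _ _ C∈)        =
  (λ i → proj₁ (𝒱-nonempty ne (C∈ i))) , (λ i → proj₂ (𝒱-nonempty ne (C∈ i)))
𝒱-nonempty ne (sub _ _ _ neB _ _)  = neB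
𝒱-nonempty ne (img _ _ C∈ h _)     =
  h₁ h (proj₁ (𝒱-nonempty ne C∈)) , h₂ h (proj₂ (𝒱-nonempty ne C∈))

just-hom : (A : Alg ℓ) → Hom A (A ⁰)
just-hom A = record { h₁ = just ; h₂ = just ; pres = λ _ _ → refl }

∈𝒱-⁰ : {A : Alg ℓ} → EverywhereNonempty A → 𝒱 (A ⁰) A
∈𝒱-⁰ {A = A} ne = sub A (A ⁰) base ne (just-hom A) (just-injective , just-injective)

module _ {ℓ : Level} (B C : Alg ℓ) where

  factor : Lift ℓ Bool → Alg ℓ
  factor (lift true)  = B
  factor (lift false) = C

  _×ᴬ_ : Alg ℓ
  _×ᴬ_ = Π-Alg (Lift ℓ Bool) factor

𝒱-× : {A B C : Alg ℓ} → 𝒱 A B → 𝒱 A C → 𝒱 A (B ×ᴬ C)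
𝒱-× {ℓ} {A} {B} {C} B∈ C∈ = prod (Lift ℓ Bool) (factor B C) factor∈
  where
  factor∈ : (i : Lift ℓ Bool) → 𝒱 A (factor B C i)
  factor∈ (lift true)  = B∈
  factor∈ (lift false) = C∈

mask : {X Y : Set ℓ} → Y → Maybe X → Maybe Y
mask y (just _) = just y
mask y nothing  = nothing

module _ {ℓ : Level} (B A : Alg ℓ) where

  mask-pres : ∀ (a : Sort₁ (B ×ᴬ (A ⁰))) (x : Sort₂ (B ×ᴬ (A ⁰))) →
    mask (s B (a (lift true)) (x (lift true))) (s⁰ A (a (lift false)) (x (lift false)))
    ≡ s⁰ B (mask (a (lift true)) (a (lift false))) (mask (x (lift true)) (x (lift false)))
  mask-pres a x with a (lift false) | x (lift false)
  ... | just _  | just _  = refl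
  ... | just _  | nothing = refl
  ... | nothing | just _  = refl
  ... | nothing | nothing = refl

  mask-hom : Hom (B ×ᴬ (A ⁰)) (B ⁰)
  mask-hom = record
    { h₁   = λ a → mask (a (lift true)) (a (lift false))
    ; h₂   = λ x → mask (x (lift true)) (x (lift false))
    ; pres = mask-pres
    }

  mask-hom-surjective : EverywhereNonempty B → EverywhereNonempty A →
                        IsSurjectiveHom mask-hom
  mask-hom-surjective (b₀ , y₀) (a₀ , x₀) = onto₁ , onto₂
    where
    onto₁ : Surjective _≡_ _≡_ (h₁ mask-hom)
    onto₁ (just b) = (λ { (lift true) → b  ; (lift false) → just a₀ }) , λ { refl → refl }
    onto₁ nothing  = (λ { (lift true) → b₀ ; (lift false) → nothing }) , λ { refl → refl }

    onto₂ : Surjective _≡_ _≡_ (h₂ mask-hom)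
    onto₂ (just y) = (λ { (lift true) → y  ; (lift false) → just x₀ }) , λ { refl → refl }
    onto₂ nothing  = (λ { (lift true) → y₀ ; (lift false) → nothing }) , λ { refl → refl }

lemma5p1 : ∀ {ℓ : Level} (A : Alg ℓ) → EverywhereNonempty A →
           ∀ (B : Alg ℓ) → 𝒱 A B → 𝒱 (A ⁰) (B ⁰)
lemma5p1 A neA B B∈ =
  img (B ⁰) (B ×ᴬ (A ⁰)) (𝒱-× (𝒱-trans (∈𝒱-⁰ neA) B∈) base)
      (mask-hom B A) (mask-hom-surjective B A (𝒱-nonempty neA B∈) neA)
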